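{- Let $k\geq 3$, $n\geq 1$, and $i\in\{0,\ldots,k-1\}$. For every $v\in[i]$ and every $j\in\{0,\ldots,k-1\}$ with $j\neq i$, we have $d(v,\overline{i_n})<d(v,\overline{j_n})$.
   Context: The Tower of Hanoi puzzle has $k$ pegs labeled $0,\ldots,k-1$ and $n$ disks labeled $0,\ldots,n-1$ by increasing size. A state is encoded by the string $a_{n-1}\cdots a_0$ with $a_i\in\{0,\ldots,k-1\}$ meaning disk $i$ lies on peg $a_i$. The graph $H_n^k$ has these $k^n$ strings as vertices, with a single edge between two vertices iff one is obtained from the other by one legal move (moving the smallest disk of some peg onto another peg that is empty or whose smallest disk is larger). $d$ is the graph distance (length of a shortest edge path). $\overline{i_n}$ denotes the string $ii\cdots i$ of length $n$. The substructure $[i]$ is the set of vertices with $a_{n-1}=i$. -}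

module Defs where

open import Data.Nat using (ℕ; zero; suc; _<_; _≤_)
open import Data.Fin using (Fin; toℕ; fromℕ)
open import Data.Vec using (Vec; lookup; replicate)
open import Data.Product using (Σ; _×_; ∃-syntax)
open import Relation.Binary.PropositionalEquality using (_≡_; _≢_)

-- A state of the Tower of Hanoi with k pegs and n disks:
-- s : Vec (Fin k) n, with  lookup s d  = peg on which disk d lies
-- (disk 0 is the smallest, disk n-1 the largest).
State : ℕ → ℕ → Set
State k n = Vec (Fin k) n

-- One legal move from s to t: disk x is moved from peg p = s[x] to
-- peg q = t[x] ≠ p; every other disk stays; x is the smallest disk on p
-- (no smaller disk on p) and peg q is empty or its smallest disk is larger
-- than x (no smaller disk on q).
record Move {k n : ℕ} (s t : State k n) : Set where
  field
    disk      : Fin n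
    moved     : lookup s disk ≢ lookup t disk
    others    : ∀ (y : Fin n) → y ≢ disk → lookup s y ≡ lookup t y
    topSource : ∀ (y : Fin n) → toℕ y < toℕ disk → lookup s y ≢ lookup s disk
    topTarget : ∀ (y : Fin n) → toℕ y < toℕ disk → lookup s y ≢ lookup t disk

Edge : {k n : ℕ} → State k n → State k n → Set
Edge = Move

data Walk {k n : ℕ} : State k n → State k n → ℕ → Set where
  here : ∀ {s} → Walk s s zero
  step : ∀ {s t u m} → Edge s t → Walk t u m → Walk s u (suc m)

IsDist : {k n : ℕ} → State k n → State k n → ℕ → Set
IsDist u v m = Walk u v m × (∀ m' → Walk u v m' → m ≤ m')

perfect : {k : ℕ} (n : ℕ) → Fin k → State k n
perfect n i = replicate n i

largest : (n : ℕ) → 1 ≤ n → Fin n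
largest (suc m) _ = fromℕ m

-- membership in the substructure [i]: largest disk on peg i
InSub : {k n : ℕ} → 1 ≤ n → Fin k → State k n → Set
InSub {n = n} h i v = lookup v (largest n h) ≡ i

-- Write a state with m+1 disks as  x ∷ʳ a : the lower m disks x and the peg a
-- of the largest disk.  The heart of the argument is a projection lemma
-- (projectWalk): a walk of length L from x ∷ʳ a to y ∷ʳ b yields a walk of the
-- lower disks from x to ρ·y, of length at most L, for a relabelling ρ of the
-- pegs with ρ b = a; the length drops strictly when a ≠ b.  One follows the
-- walk, keeping the moves of lower disks; a move a → a' of the largest disk is
-- deleted, and the labels a, a' are swapped on the rest of the walk — harmless
-- because no lower disk sits on a or a' at that moment.  For the target j…j
-- with j ≠ i this turns a shortest walk v → j…j into a strictly shorter walk
-- v → i…i (shorterToOwnPeg).  For distances to exist at all we show that the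
-- graph is connected when k ≥ 3 (walkToPerfect, the recursive solution) and
-- that walks of a given length are decidable, so a least length exists.
module Submission where

open import Defs
open import Data.Nat using (ℕ; zero; suc; _≤_; _<_; _+_; z≤n; s≤s)
open import Data.Nat.Properties
  using (<-asym; <-irrefl; ≤-trans; ≤-<-trans; n≤1+n; _<?_; +-suc; +-identityʳ; ≮⇒≥; m≤n⇒m<n∨m≡n)
open import Data.Fin using (Fin; toℕ; fromℕ; inject₁; zero; suc; _≟_)
open import Data.Fin.Properties
  using (toℕ-fromℕ; toℕ-inject₁; toℕ<n; fromℕ≢inject₁; inject₁-injective; any?; all?)
open import Data.Fin.Permutation.Components using (transpose; transpose-inverse)
open import Data.Vec using (Vec; []; _∷_; lookup; replicate; _∷ʳ_; map; tabulate; initLast; _[_]≔_)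
open import Data.Vec.Properties
  using (lookup-map; lookup-replicate; map-replicate; map-id; tabulate∘lookup; tabulate-cong; ∷ʳ-injective;
         lookup∘update; lookup∘update′; ≡-dec)
open import Data.Product using (_×_; ∃-syntax; _,_; proj₂)
open import Data.Sum using (_⊎_; inj₁; inj₂; map₂)
open import Data.Empty using (⊥-elim)
open import Function.Base using (_∘_; id)
open import Function.Definitions using (Injective)
open import Relation.Nullary using (¬_; Dec; yes; no)
open import Relation.Nullary.Decidable using (map′; ¬?; _→-dec_; _×-dec_; dec-true; dec-false)
open import Relation.Unary using (Decidable)
open import Relation.Binary.PropositionalEquality
open ≡-Reasoning

lookup-ext : ∀ {A : Set} {m} (xs ys : Vec A m) → (∀ i → lookup xs i ≡ lookup ys i) → xs ≡ ys
lookup-ext xs ys agree = begin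
  xs                   ≡⟨ sym (tabulate∘lookup xs) ⟩
  tabulate (lookup xs) ≡⟨ tabulate-cong agree ⟩
  tabulate (lookup ys) ≡⟨ tabulate∘lookup ys ⟩
  ys                   ∎

lookup-∷ʳ-inject₁ : ∀ {A : Set} {m} (x : Vec A m) a (i : Fin m) → lookup (x ∷ʳ a) (inject₁ i) ≡ lookup x i
lookup-∷ʳ-inject₁ (_ ∷ x) a zero    = refl
lookup-∷ʳ-inject₁ (_ ∷ x) a (suc i) = lookup-∷ʳ-inject₁ x a i

lookup-∷ʳ-last : ∀ {A : Set} {m} (x : Vec A m) a → lookup (x ∷ʳ a) (fromℕ m) ≡ a
lookup-∷ʳ-last []      a = refl
lookup-∷ʳ-last (_ ∷ x) a = lookup-∷ʳ-last x a

replicate-∷ʳ : ∀ {A : Set} m (a : A) → replicate m a ∷ʳ a ≡ replicate (suc m) a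
replicate-∷ʳ zero    a = refl
replicate-∷ʳ (suc m) a = cong (a ∷_) (replicate-∷ʳ m a)

largestOrLower : ∀ {m} (d : Fin (suc m)) → d ≡ fromℕ m ⊎ ∃[ d' ] d ≡ inject₁ d'
largestOrLower {zero}  zero    = inj₁ refl
largestOrLower {suc m} zero    = inj₂ (zero , refl)
largestOrLower {suc m} (suc d) with largestOrLower d
... | inj₁ refl       = inj₁ refl
... | inj₂ (d' , refl) = inj₂ (suc d' , refl)

belowLower : ∀ {m} (y : Fin (suc m)) (d : Fin m) → toℕ y < toℕ (inject₁ d) → ∃[ y' ] y ≡ inject₁ y'
belowLower {m} y d y<d with largestOrLower y
... | inj₂ lower = lower
... | inj₁ refl  = ⊥-elim (<-asym (toℕ<n d) (subst₂ _<_ (toℕ-fromℕ m) (toℕ-inject₁ d) y<d))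

inject₁<fromℕ : ∀ {m} (i : Fin m) → toℕ (inject₁ i) < toℕ (fromℕ m)
inject₁<fromℕ {m} i = subst₂ _<_ (sym (toℕ-inject₁ i)) (sym (toℕ-fromℕ m)) (toℕ<n i)

inject₁-mono : ∀ {m} {i j : Fin m} → toℕ i < toℕ j → toℕ (inject₁ i) < toℕ (inject₁ j)
inject₁-mono {i = i} {j} = subst₂ _<_ (sym (toℕ-inject₁ i)) (sym (toℕ-inject₁ j))

_++ʷ_ : ∀ {k n} {s t u : State k n} {L L'} → Walk s t L → Walk t u L' → Walk s u (L + L')
here       ++ʷ w' = w'
step e w   ++ʷ w' = step e (w ++ʷ w')

transpose-right : ∀ {k} (a b : Fin k) → transpose a b b ≡ a
transpose-right a b with b ≟ a
... | yes b≡a = b≡a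
... | no _ rewrite dec-true (b ≟ b) refl = refl

transpose-fixes : ∀ {k} {a b c : Fin k} → c ≢ a → c ≢ b → transpose a b c ≡ c
transpose-fixes {a = a} {b} {c} c≢a c≢b rewrite dec-false (c ≟ a) c≢a | dec-false (c ≟ b) c≢b = refl

transpose-injective : ∀ {k} (a b : Fin k) → Injective _≡_ _≡_ (transpose a b)
transpose-injective a b {c} {d} eq = begin
  c                               ≡⟨ sym (transpose-inverse b a) ⟩
  transpose b a (transpose a b c) ≡⟨ cong (transpose b a) eq ⟩
  transpose b a (transpose a b d) ≡⟨ transpose-inverse b a ⟩
  d                               ∎

module _ {k : ℕ} where

  Avoids : ∀ {m} → State k m → Fin k → Set
  Avoids x a = ∀ i → lookup x i ≢ a

  liftMove : ∀ {m} {x y : State k m} (a : Fin k) → Move x y → Move (x ∷ʳ a) (y ∷ʳ a)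
  liftMove {m} {x} {y} a e = record
    { disk      = inject₁ disk
    ; moved     = λ eq → moved (trans (sym (lookup-∷ʳ-inject₁ x a disk)) (trans eq (lookup-∷ʳ-inject₁ y a disk)))
    ; others    = othersFixed
    ; topSource = liftFree x topSource
    ; topTarget = liftFree y topTarget
    }
    where
    open Move e
    othersFixed : ∀ z → z ≢ inject₁ disk → lookup (x ∷ʳ a) z ≡ lookup (y ∷ʳ a) z
    othersFixed z z≢d with largestOrLower z
    ... | inj₁ refl = trans (lookup-∷ʳ-last x a) (sym (lookup-∷ʳ-last y a))
    ... | inj₂ (z' , refl) =
      trans (lookup-∷ʳ-inject₁ x a z')
            (trans (others z' (λ eq → z≢d (cong inject₁ eq))) (sym (lookup-∷ʳ-inject₁ y a z')))
    liftFree : (t : State k m) → (∀ z → toℕ z < toℕ disk → lookup x z ≢ lookup t disk) →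
               ∀ z → toℕ z < toℕ (inject₁ disk) → lookup (x ∷ʳ a) z ≢ lookup (t ∷ʳ a) (inject₁ disk)
    liftFree t free z z<d with belowLower z disk z<d
    ... | z' , refl = λ eq →
      free z' (subst₂ _<_ (toℕ-inject₁ z') (toℕ-inject₁ disk) z<d)
           (trans (sym (lookup-∷ʳ-inject₁ x a z')) (trans eq (lookup-∷ʳ-inject₁ t a disk)))

  liftWalk : ∀ {m} {x y : State k m} {L} (a : Fin k) → Walk x y L → Walk (x ∷ʳ a) (y ∷ʳ a) L
  liftWalk a here       = here
  liftWalk a (step e w) = step (liftMove a e) (liftWalk a w)

  largestMove : ∀ {m} (x : State k m) {a b : Fin k} → a ≢ b → Avoids x a → Avoids x b →
                Move (x ∷ʳ a) (x ∷ʳ b)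
  largestMove {m} x {a} {b} a≢b avoidA avoidB = record
    { disk      = fromℕ m
    ; moved     = λ eq → a≢b (trans (sym (lookup-∷ʳ-last x a)) (trans eq (lookup-∷ʳ-last x b)))
    ; others    = othersFixed
    ; topSource = λ z z<m → free avoidA z (subst (toℕ z <_) (toℕ-fromℕ m) z<m)
    ; topTarget = λ z z<m → free avoidB z (subst (toℕ z <_) (toℕ-fromℕ m) z<m)
    }
    where
    othersFixed : ∀ z → z ≢ fromℕ m → lookup (x ∷ʳ a) z ≡ lookup (x ∷ʳ b) z
    othersFixed z z≢last with largestOrLower z
    ... | inj₁ z≡last     = ⊥-elim (z≢last z≡last)
    ... | inj₂ (z' , refl) = trans (lookup-∷ʳ-inject₁ x a z') (sym (lookup-∷ʳ-inject₁ x b z'))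
    free : ∀ {c} → Avoids x c → ∀ z → toℕ z < m → lookup (x ∷ʳ a) z ≢ lookup (x ∷ʳ c) (fromℕ m)
    free {c} avoidC z z<m with largestOrLower z
    ... | inj₁ refl       = ⊥-elim (<-irrefl (toℕ-fromℕ m) z<m)
    ... | inj₂ (z' , refl) = λ eq →
      avoidC z' (trans (sym (lookup-∷ʳ-inject₁ x a z')) (trans eq (lookup-∷ʳ-last x c)))

  classifyMove : ∀ {m} {x y : State k m} {a b : Fin k} → Move (x ∷ʳ a) (y ∷ʳ b) →
                 (a ≡ b × Move x y) ⊎ (x ≡ y × a ≢ b × Avoids x a × Avoids x b)
  classifyMove {m} {x} {y} {a} {b} e with largestOrLower (Move.disk e)
  ... | inj₁ disk≡last = inj₂ (lookup-ext x y lowerFixed , a≢b , free x topSource , free y topTarget)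
    where
    open Move e
    atDisk : ∀ {c} (z : State k m) → lookup (z ∷ʳ c) disk ≡ c
    atDisk {c} z = trans (cong (lookup (z ∷ʳ c)) disk≡last) (lookup-∷ʳ-last z c)
    lowerFixed : ∀ i → lookup x i ≡ lookup y i
    lowerFixed i = trans (sym (lookup-∷ʳ-inject₁ x a i))
      (trans (others (inject₁ i) (λ eq → fromℕ≢inject₁ (sym (trans eq disk≡last))))
             (lookup-∷ʳ-inject₁ y b i))
    a≢b : a ≢ b
    a≢b a≡b = moved (trans (atDisk x) (trans a≡b (sym (atDisk y))))
    free : ∀ {c} (t : State k m) → (∀ z → toℕ z < toℕ disk → lookup (x ∷ʳ a) z ≢ lookup (t ∷ʳ c) disk) →
           Avoids x c
    free t noneBelow i xi≡c = noneBelow (inject₁ i)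
      (subst (λ d → toℕ (inject₁ i) < toℕ d) (sym disk≡last) (inject₁<fromℕ i))
      (trans (lookup-∷ʳ-inject₁ x a i) (trans xi≡c (sym (atDisk t))))
  ... | inj₂ (d , disk≡d) = inj₁ (a≡b , record
    { disk      = d
    ; moved     = λ eq → moved (trans (atDisk x) (trans eq (sym (atDisk y))))
    ; others    = λ z z≢d → trans (sym (lookup-∷ʳ-inject₁ x a z))
                    (trans (others (inject₁ z) (λ eq → z≢d (inject₁-injective (trans eq disk≡d))))
                           (lookup-∷ʳ-inject₁ y b z))
    ; topSource = lowerFree x topSource
    ; topTarget = lowerFree y topTarget
    })
    where
    open Move e
    atDisk : ∀ {c} (z : State k m) → lookup (z ∷ʳ c) disk ≡ lookup z d
    atDisk {c} z = trans (cong (lookup (z ∷ʳ c)) disk≡d) (lookup-∷ʳ-inject₁ z c d)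
    a≡b : a ≡ b
    a≡b = trans (sym (lookup-∷ʳ-last x a))
      (trans (others (fromℕ m) (λ eq → fromℕ≢inject₁ (trans eq disk≡d))) (lookup-∷ʳ-last y b))
    lowerFree : ∀ {c} (t : State k m) → (∀ z → toℕ z < toℕ disk → lookup (x ∷ʳ a) z ≢ lookup (t ∷ʳ c) disk) →
                ∀ z → toℕ z < toℕ d → lookup x z ≢ lookup t d
    lowerFree t noneBelow z z<d eq = noneBelow (inject₁ z)
      (subst (λ d' → toℕ (inject₁ z) < toℕ d') (sym disk≡d) (inject₁-mono z<d))
      (trans (lookup-∷ʳ-inject₁ x a z) (trans eq (sym (atDisk t))))

  relabelMove : ∀ {m} {x y : State k m} (π : Fin k → Fin k) → Injective _≡_ _≡_ π →
                Move x y → Move (map π x) (map π y)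
  relabelMove {x = x} {y} π π-inj e = record
    { disk      = disk
    ; moved     = λ eq → moved (unrelabel x y disk disk eq)
    ; others    = λ z z≢d → trans (lookup-map z π x) (trans (cong π (others z z≢d)) (sym (lookup-map z π y)))
    ; topSource = λ z z<d eq → topSource z z<d (unrelabel x x z disk eq)
    ; topTarget = λ z z<d eq → topTarget z z<d (unrelabel x y z disk eq)
    }
    where
    open Move e
    unrelabel : ∀ s t i j → lookup (map π s) i ≡ lookup (map π t) j → lookup s i ≡ lookup t j
    unrelabel s t i j eq = π-inj (trans (sym (lookup-map i π s)) (trans eq (lookup-map j π t)))


  -- Moves of the
  -- largest disk a → a' are dropped and compensated by swapping a and a' in π.
  projectWalk : ∀ {m} {s t : State k (suc m)} {L} {x y : State k m} {a b : Fin k} →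
                (π : Fin k → Fin k) → Injective _≡_ _≡_ π →
                Walk s t L → s ≡ x ∷ʳ a → t ≡ y ∷ʳ b →
                ∃[ ρ ] ρ b ≡ π a × ∃[ L' ] Walk (map π x) (map ρ y) L' × L' ≤ L × (a ≡ b ⊎ L' < L)
  projectWalk {x = x} {y} π π-inj here s≡xa s≡yb with ∷ʳ-injective x y (trans (sym s≡xa) s≡yb)
  ... | refl , refl = π , refl , 0 , here , z≤n , inj₁ refl
  projectWalk π π-inj (step {t = s'} e w) refl t≡yb with initLast s'
  ... | x' , a' , refl with classifyMove e
  ... | inj₁ (refl , lowerMove) with projectWalk π π-inj w refl t≡yb
  ...   | ρ , ρb≡πa , L' , w' , L'≤L , shorter =
          ρ , ρb≡πa , suc L' , step (relabelMove π π-inj lowerMove) w' , s≤s L'≤L , map₂ s≤s shorter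
  projectWalk {x = x} {y} {a} π π-inj (step {t = s'} e w) refl t≡yb | x' , a' , refl
    | inj₂ (refl , _ , avoidA , avoidA')
    with projectWalk (π ∘ transpose a a') (λ eq → transpose-injective a a' (π-inj eq)) w refl t≡yb
  ... | ρ , ρb≡πτa' , L' , w' , L'≤L , _ =
          ρ , trans ρb≡πτa' (cong π (transpose-right a a')) ,
          L' , subst (λ z → Walk z (map ρ y) L') swapInvisible w' , ≤-trans L'≤L (n≤1+n _) , inj₂ (s≤s L'≤L)
    where
    -- the lower disks avoid a and a', so swapping these pegs does not affect them
    swapInvisible : map (π ∘ transpose a a') x ≡ map π x
    swapInvisible = lookup-ext _ _ λ i → begin
      lookup (map (π ∘ transpose a a') x) i ≡⟨ lookup-map i _ x ⟩
      π (transpose a a' (lookup x i))       ≡⟨ cong π (transpose-fixes (avoidA i) (avoidA' i)) ⟩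
      π (lookup x i)                        ≡⟨ sym (lookup-map i π x) ⟩
      lookup (map π x) i                    ∎

  liftToPerfect : ∀ {m L} {x : State k m} (a : Fin k) → Walk x (perfect m a) L → Walk (x ∷ʳ a) (perfect (suc m) a) L
  liftToPerfect {m} {L} {x} a w = subst (λ t → Walk (x ∷ʳ a) t L) (replicate-∷ʳ m a) (liftWalk a w)

  shorterToOwnPeg : ∀ {m L} (x : State k m) {a b : Fin k} → a ≢ b →
                    Walk (x ∷ʳ a) (perfect (suc m) b) L →
                    ∃[ L' ] L' < L × Walk (x ∷ʳ a) (perfect (suc m) a) L'
  shorterToOwnPeg {m} x {a} {b} a≢b w with projectWalk id (λ eq → eq) w refl (sym (replicate-∷ʳ m b))
  ... | _ , _ , _ , _ , _ , inj₁ a≡b = ⊥-elim (a≢b a≡b)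
  ... | ρ , ρb≡a , L' , w' , _ , inj₂ L'<L =
        L' , L'<L , liftToPerfect a (subst₂ (λ s t → Walk s t L') (map-id x) relabelledTarget w')
    where
    relabelledTarget : map ρ (replicate m b) ≡ replicate m a
    relabelledTarget = trans (map-replicate ρ b m) (cong (replicate m) ρb≡a)

thirdPeg : ∀ {k'} (a b : Fin (3 + k')) → ∃[ c ] c ≢ a × c ≢ b
thirdPeg (suc a)       (suc b)       = zero , (λ ()) , (λ ())
thirdPeg zero          zero          = suc zero , (λ ()) , (λ ())
thirdPeg zero          (suc zero)    = suc (suc zero) , (λ ()) , (λ ())
thirdPeg zero          (suc (suc b)) = suc zero , (λ ()) , (λ ())
thirdPeg (suc zero)    zero          = suc (suc zero) , (λ ()) , (λ ())
thirdPeg (suc (suc a)) zero          = suc zero , (λ ()) , (λ ())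

-- Either the
-- largest disk is already in place, or the lower disks are gathered on a third
-- peg c, the largest disk moves, and the lower disks follow it.
walkToPerfect : ∀ {k'} m (x : State (3 + k') m) (p : Fin (3 + k')) → ∃[ L ] Walk x (perfect m p) L
walkToPerfect zero    []  p = 0 , here
walkToPerfect (suc m) s   p with initLast s
... | x , a , refl with a ≟ p
... | yes refl = let L , w = walkToPerfect m x a in L , liftToPerfect a w
... | no a≢p with thirdPeg a p
... | c , c≢a , c≢p =
  let L₁ , gather = walkToPerfect m x c
      L₂ , follow = walkToPerfect m (perfect m c) p
  in L₁ + suc L₂ ,
     liftWalk a gather ++ʷ step (largestMove (perfect m c) a≢p (offPeg c≢a) (offPeg c≢p)) (liftToPerfect p follow)
  where
  offPeg : ∀ {d} → c ≢ d → Avoids (perfect m c) d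
  offPeg c≢d i eq = c≢d (trans (sym (lookup-replicate i c)) eq)

Least : (ℕ → Set) → ℕ → Set
Least P m = P m × (∀ m' → P m' → m ≤ m')

leastFrom : ∀ {P : ℕ → Set} → Decidable P → ∀ b c → (∀ m → m < c → ¬ P m) → P (b + c) → ∃[ m ] Least P m
leastFrom P? b c failsBelow p with P? c
... | yes pc = c , pc , λ m' pm' → ≮⇒≥ (λ m'<c → failsBelow m' m'<c pm')
leastFrom P? zero    c failsBelow p | no ¬pc = ⊥-elim (¬pc p)
leastFrom {P} P? (suc b) c failsBelow p | no ¬pc =
  leastFrom P? b (suc c) failsBelow' (subst P (sym (+-suc b c)) p)
  where
  failsBelow' : ∀ m → m < suc c → ¬ P m
  failsBelow' m (s≤s m≤c) with m≤n⇒m<n∨m≡n m≤c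
  ... | inj₁ m<c  = failsBelow m m<c
  ... | inj₂ refl = ¬pc

least : ∀ {P : ℕ → Set} → Decidable P → ∀ {n} → P n → ∃[ m ] Least P m
least {P} P? {n} p = leastFrom P? n 0 (λ _ ()) (subst P (sym (+-identityʳ n)) p)

module _ {k n : ℕ} where

  -- Legality of a move is decidable: all its conditions quantify over Fin n.
  move? : (s t : State k n) → Dec (Move s t)
  move? s t = map′
    (λ { (d , mv , ot , ts , tt) → record { disk = d ; moved = mv ; others = ot ; topSource = ts ; topTarget = tt } })
    (λ e → Move.disk e , Move.moved e , Move.others e , Move.topSource e , Move.topTarget e)
    (any? λ d → ¬? (lookup s d ≟ lookup t d)
           ×-dec all? (λ y → ¬? (y ≟ d) →-dec (lookup s y ≟ lookup t y))
           ×-dec all? (λ y → (toℕ y <? toℕ d) →-dec ¬? (lookup s y ≟ lookup s d))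
           ×-dec all? (λ y → (toℕ y <? toℕ d) →-dec ¬? (lookup s y ≟ lookup t d)))

  -- A move changes only the peg of its disk, so s has finitely many neighbours.
  move-update : ∀ {s t : State k n} (e : Move s t) → t ≡ s [ Move.disk e ]≔ lookup t (Move.disk e)
  move-update {s} {t} e = lookup-ext _ _ agree
    where
    agree : ∀ i → lookup t i ≡ lookup (s [ Move.disk e ]≔ lookup t (Move.disk e)) i
    agree i with i ≟ Move.disk e
    ... | yes refl = sym (lookup∘update i s _)
    ... | no i≢d   = trans (sym (Move.others e i i≢d)) (sym (lookup∘update′ i≢d s _))

  walk? : (s t : State k n) → Decidable (Walk s t)
  walk? s t zero with ≡-dec _≟_ s t
  ... | yes refl = yes here
  ... | no s≢t   = no λ { here → s≢t refl }
  walk? s t (suc L) = map′ viaNeighbour firstStep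
    (any? λ d → any? λ q → move? s (s [ d ]≔ q) ×-dec walk? (s [ d ]≔ q) t L)
    where
    Neighbour : Set
    Neighbour = ∃[ d ] ∃[ q ] Move s (s [ d ]≔ q) × Walk (s [ d ]≔ q) t L
    viaNeighbour : Neighbour → Walk s t (suc L)
    viaNeighbour (_ , _ , e , w) = step e w
    firstStep : Walk s t (suc L) → Neighbour
    firstStep (step {t = u} e w) = Move.disk e , lookup u (Move.disk e) ,
      subst (Move s) (move-update e) e , subst (λ z → Walk z t L) (move-update e) w

  distance : ∀ {s t : State k n} {L} → Walk s t L → ∃[ d ] IsDist s t d
  distance {s} {t} = least (walk? s t)

lemma5 : (k n : ℕ) → 3 ≤ k → (h : 1 ≤ n) → (i : Fin k) →
    (v : State k n) → InSub h i v → (j : Fin k) → j ≢ i →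
    ∃[ d₁ ] ∃[ d₂ ] (IsDist v (perfect n i) d₁ × IsDist v (perfect n j) d₂ × d₁ < d₂)
lemma5 (suc (suc (suc k'))) (suc m) (s≤s (s≤s (s≤s z≤n))) (s≤s z≤n) i v largestOnI j j≢i
  with initLast v
... | x , a , refl with trans (sym (lookup-∷ʳ-last x a)) largestOnI
... | refl with distance (proj₂ (walkToPerfect (suc m) (x ∷ʳ a) j))
... | d₂ , toJ@(shortestToJ , _) with shorterToOwnPeg x (λ a≡j → j≢i (sym a≡j)) shortestToJ
... | L , L<d₂ , walkToI with distance walkToI
... | d₁ , toI@(_ , minimal) = d₁ , d₂ , toI , toJ , ≤-<-trans (minimal L walkToI) L<d₂
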